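{- Let $L$ be a Latin square of order $n\geq 3$. Then the set of cells of every quasi-transversal in $L$ is a $3$-dominating set of cardinality $n+1$ in the Latin square graph $L_3(L,n)$.
   Context: A Latin square of order $n$ is an $n\times n$ array $L=(\ell_{i,j})$ with entries from $[n]$ such that no symbol appears twice in any row or column. A quasi-transversal in $L$ is a set of $n+1$ cells which includes exactly two cells from one row and exactly two cells from one column, and exactly one cell from each other row and each other column, and in which all symbols except one occur exactly once (so one symbol occurs twice). The Latin square graph $L_3(L,n)$ has vertex set $\{(i,j)\mid 1\le i,j\le n\}$, with distinct $(i,j),(p,q)$ adjacent iff $i=p$ or $j=q$ or $\ell_{i,j}=\ell_{p,q}$. A set $S$ of vertices of a graph is $3$-dominating if every vertex outside $S$ has at least $3$ neighbours in $S$. -}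

module Defs where

open import Data.Nat using (ℕ; suc; _≤_)
open import Data.Fin using (Fin)
open import Data.Fin.Properties using (_≟_)
open import Data.Product using (_×_; _,_; proj₁; proj₂; Σ; ∃; ∃-syntax)
open import Data.Product.Properties using (≡-dec)
open import Data.Sum using (_⊎_)
open import Data.List using (List; length; filter)
open import Data.List.Relation.Unary.Unique.Propositional using (Unique)
open import Data.List.Membership.Propositional using (_∈_; _∉_)
open import Relation.Binary.PropositionalEquality using (_≡_; _≢_)
open import Relation.Nullary using (¬_; Dec)
open import Relation.Nullary.Decidable using (_×-dec_; _⊎-dec_; ¬?)

Square : ℕ → Set
Square n = Fin n → Fin n → Fin n

IsLatin : {n : ℕ} → Square n → Set
IsLatin {n} L =
  (∀ (i j k : Fin n) → L i j ≡ L i k → j ≡ k) ×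
  (∀ (i j k : Fin n) → L i k ≡ L j k → i ≡ j)

Cell : ℕ → Set
Cell n = Fin n × Fin n

row : {n : ℕ} → Cell n → Fin n
row = proj₁

col : {n : ℕ} → Cell n → Fin n
col = proj₂

sym : {n : ℕ} → Square n → Cell n → Fin n
sym L (i , j) = L i j

_≟ᶜ_ : {n : ℕ} → (c d : Cell n) → Dec (c ≡ d)
_≟ᶜ_ = ≡-dec _≟_ _≟_

rowCount : {n : ℕ} → Fin n → List (Cell n) → ℕ
rowCount r S = length (filter (λ x → row x ≟ r) S)

colCount : {n : ℕ} → Fin n → List (Cell n) → ℕ
colCount c S = length (filter (λ x → col x ≟ c) S)

symCount : {n : ℕ} → Square n → Fin n → List (Cell n) → ℕ
symCount L s S = length (filter (λ x → sym L x ≟ s) S)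

IsQuasiTransversal : {n : ℕ} → Square n → List (Cell n) → Set
IsQuasiTransversal {n} L S =
  Unique S ×
  length S ≡ suc n ×
  (∃[ r ] (rowCount r S ≡ 2 × (∀ r′ → r′ ≢ r → rowCount r′ S ≡ 1))) ×
  (∃[ c ] (colCount c S ≡ 2 × (∀ c′ → c′ ≢ c → colCount c′ S ≡ 1))) ×
  (∃[ s ] (symCount L s S ≡ 2 × (∀ s′ → s′ ≢ s → symCount L s′ S ≡ 1)))

Adj : {n : ℕ} → Square n → Cell n → Cell n → Set
Adj L u v = ¬ (u ≡ v) × (row u ≡ row v ⊎ col u ≡ col v ⊎ sym L u ≡ sym L v)

adj? : {n : ℕ} → (L : Square n) → (u v : Cell n) → Dec (Adj L u v)
adj? L u v = ¬? (u ≟ᶜ v) ×-dec (row u ≟ row v ⊎-dec (col u ≟ col v ⊎-dec sym L u ≟ sym L v))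

-- number of neighbours of v in S (S duplicate-free)
nbrCount : {n : ℕ} → Square n → Cell n → List (Cell n) → ℕ
nbrCount L v S = length (filter (adj? L v) S)

Is3Dominating : {n : ℕ} → Square n → List (Cell n) → Set
Is3Dominating {n} L S = ∀ (v : Cell n) → v ∉ S → 3 ≤ nbrCount L v S

module Submission where

-- A quasi-transversal S meets every row, every column and every
-- symbol: each of these counts is 1 or 2, hence positive.  The theorem then
-- follows from a statement about arbitrary cell sets: if S meets every row,
-- column and symbol of a Latin square L, then S is 3-dominating in L₃(L,n).
-- Indeed, for a cell v = (i , j) outside S pick a ∈ S in row i, b ∈ S in
-- column j and c ∈ S carrying the symbol L i j.  All three are neighbours of
-- v, and they are pairwise distinct: two of them coinciding would give a cell
-- of S sharing two of row, column, symbol with v, and in a Latin square any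
-- two of these determine the cell, so it would be v itself.

open import Defs
open import Data.Nat using (ℕ; suc; _≤_; z≤n; s≤s)
open import Data.Fin using (Fin)
open import Data.Fin.Properties using (_≟_)
open import Data.List using (List; _∷_; length; filter)
open import Data.List.Relation.Unary.Any using (here; there)
open import Data.List.Relation.Unary.Unique.Propositional using (Unique)
open import Data.List.Membership.Propositional using (_∈_; _∉_)
open import Data.List.Membership.Propositional.Properties
  using (∈-filter⁺; ∈-filter⁻; ∈-length)
open import Data.Product using (_×_; _,_; ∃-syntax)
open import Data.Product.Properties using (×-≡,≡→≡)
open import Data.Sum using (_⊎_; inj₁; inj₂)
open import Data.Empty using (⊥-elim)
open import Relation.Binary.Definitions using (DecidableEquality)
open import Relation.Binary.PropositionalEquality
  using (_≡_; _≢_; refl; cong; subst; trans; ≢-sym) renaming (sym to ≡-sym)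
open import Relation.Nullary using (yes; no)

∈-tail : {A : Set} {x y : A} {ys : List A} → x ∈ y ∷ ys → x ≢ y → x ∈ ys
∈-tail (here x≡y) x≢y = ⊥-elim (x≢y x≡y)
∈-tail (there x∈ys) _ = x∈ys

two-distinct-members : {A : Set} {a b : A} {xs : List A} →
  a ∈ xs → b ∈ xs → a ≢ b → 2 ≤ length xs
two-distinct-members (here refl) b∈ a≢b = s≤s (∈-length (∈-tail b∈ (≢-sym a≢b)))
two-distinct-members (there a∈)  _  _   = s≤s (∈-length a∈)

three-distinct-members : {A : Set} {a b c : A} {xs : List A} →
  a ∈ xs → b ∈ xs → c ∈ xs → a ≢ b → a ≢ c → b ≢ c → 3 ≤ length xs
three-distinct-members (here refl) b∈ c∈ a≢b a≢c b≢c =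
  s≤s (two-distinct-members (∈-tail b∈ (≢-sym a≢b))
                            (∈-tail c∈ (≢-sym a≢c)) b≢c)
three-distinct-members (there a∈) (here refl) c∈ a≢b a≢c b≢c =
  s≤s (two-distinct-members a∈ (∈-tail c∈ (≢-sym b≢c)) a≢c)
three-distinct-members (there a∈) (there b∈) _ a≢b _ _ =
  s≤s (two-distinct-members a∈ b∈ a≢b)

count : {A K : Set} → DecidableEquality K → (A → K) → K → List A → ℕ
count _≟ᴷ_ f k xs = length (filter (λ x → f x ≟ᴷ k) xs)

Occurs : {A K : Set} → (A → K) → K → List A → Set
Occurs f k xs = ∃[ x ] (x ∈ xs × f x ≡ k)

nonempty⇒member : {A : Set} {ys : List A} → 1 ≤ length ys → ∃[ y ] y ∈ ys
nonempty⇒member {ys = y ∷ _} _ = y , here refl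

positive-count⇒occurs : {A K : Set} (_≟ᴷ_ : DecidableEquality K) (f : A → K) (k : K)
  (xs : List A) → 1 ≤ count _≟ᴷ_ f k xs → Occurs f k xs
positive-count⇒occurs _≟ᴷ_ f k xs positive with nonempty⇒member positive
... | x , x∈filter = x , ∈-filter⁻ (λ y → f y ≟ᴷ k) {xs = xs} x∈filter

one-or-two⇒occurs : {A K : Set} (_≟ᴷ_ : DecidableEquality K) (f : A → K) (xs : List A) →
  (∃[ k₀ ] (count _≟ᴷ_ f k₀ xs ≡ 2 × (∀ k → k ≢ k₀ → count _≟ᴷ_ f k xs ≡ 1))) →
  ∀ k → Occurs f k xs
one-or-two⇒occurs _≟ᴷ_ f xs (k₀ , twice , once) k with k ≟ᴷ k₀
... | yes refl  = positive-count⇒occurs _≟ᴷ_ f k xs (subst (1 ≤_) (≡-sym twice) (s≤s z≤n))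
... | no k≢k₀ = positive-count⇒occurs _≟ᴷ_ f k xs (subst (1 ≤_) (≡-sym (once k k≢k₀)) (s≤s z≤n))

MeetsEveryLine : {n : ℕ} → Square n → List (Cell n) → Set
MeetsEveryLine {n} L S =
  (∀ (i : Fin n) → Occurs row i S) ×
  (∀ (j : Fin n) → Occurs col j S) ×
  (∀ (s : Fin n) → Occurs (sym L) s S)

quasiTransversal-meets-every-line : {n : ℕ} (L : Square n) (S : List (Cell n)) →
  IsQuasiTransversal L S → MeetsEveryLine L S
quasiTransversal-meets-every-line L S (_ , _ , rows , cols , syms) =
  one-or-two⇒occurs _≟_ row S rows ,
  one-or-two⇒occurs _≟_ col S cols ,
  one-or-two⇒occurs _≟_ (sym L) S syms

row-col-determine : {n : ℕ} {x y : Cell n} → row x ≡ row y → col x ≡ col y → x ≡ y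
row-col-determine same-row same-col = ×-≡,≡→≡ (same-row , same-col)

row-sym-determine : {n : ℕ} {L : Square n} → IsLatin L → {x y : Cell n} →
  row x ≡ row y → sym L x ≡ sym L y → x ≡ y
row-sym-determine (rows-latin , _) {i , j} {.i , k} refl same-sym =
  cong (i ,_) (rows-latin i j k same-sym)

col-sym-determine : {n : ℕ} {L : Square n} → IsLatin L → {x y : Cell n} →
  col x ≡ col y → sym L x ≡ sym L y → x ≡ y
col-sym-determine (_ , cols-latin) {i , j} {k , .j} refl same-sym =
  cong (_, j) (cols-latin i k j same-sym)

shared-line⇒neighbour : {n : ℕ} (L : Square n) {S : List (Cell n)} {v x : Cell n} →
  v ∉ S → x ∈ S → (row v ≡ row x ⊎ col v ≡ col x ⊎ sym L v ≡ sym L x) →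
  x ∈ filter (adj? L v) S
shared-line⇒neighbour L v∉S x∈S shared =
  ∈-filter⁺ (adj? L _) x∈S ((λ { refl → v∉S x∈S }) , shared)

meets-every-line⇒3-dominating : {n : ℕ} (L : Square n) → IsLatin L →
  (S : List (Cell n)) → MeetsEveryLine L S → Is3Dominating L S
meets-every-line⇒3-dominating L latin S (rows , cols , syms) v v∉S
  with rows (row v) | cols (col v) | syms (sym L v)
... | a , a∈S , a-row | b , b∈S , b-col | c , c∈S , c-sym =
  three-distinct-members
    (shared-line⇒neighbour L v∉S a∈S (inj₁ (≡-sym a-row)))
    (shared-line⇒neighbour L v∉S b∈S (inj₂ (inj₁ (≡-sym b-col))))
    (shared-line⇒neighbour L v∉S c∈S (inj₂ (inj₂ (≡-sym c-sym))))
    a≢b a≢c b≢c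
  where
  outside : ∀ {x} → x ∈ S → x ≢ v
  outside x∈S refl = v∉S x∈S

  a≢b : a ≢ b
  a≢b a≡b = outside a∈S (row-col-determine a-row (trans (cong col a≡b) b-col))

  a≢c : a ≢ c
  a≢c a≡c = outside a∈S (row-sym-determine latin a-row (trans (cong (sym L) a≡c) c-sym))

  b≢c : b ≢ c
  b≢c b≡c = outside b∈S (col-sym-determine latin b-col (trans (cong (sym L) b≡c) c-sym))

proposition3p2 : (n : ℕ) → 3 ≤ n → (L : Square n) → IsLatin L →
    (S : List (Cell n)) → IsQuasiTransversal L S →
    Is3Dominating L S × Unique S × length S ≡ suc n
proposition3p2 n _ L latin S qt@(unique , size , _) =
  meets-every-line⇒3-dominating L latin S (quasiTransversal-meets-every-line L S qt) ,
  unique ,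
  size
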